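{- Let $G$ be a finite simple connected graph satisfying property (P3), and let $R$ be an induced subgraph of $G$ witnessing (P3). Then for any $c\in V(R)$, $x\in V(G)$ with $d(c,x)\ge 2$, and any $c_1,c_2\in C(c,x)$, we have $N[c_1]=N[c_2]$.
   Context: $d$ is the distance in $G$, $N(x)$ the neighbourhood, $N[x]=N(x)\cup\{x\}$, $N[R]=\bigcup_{r\in V(R)}N[r]$. For $d(c,x)\ge 2$: $N(c,x)=\{v\in N(c): d(c,x)=1+d(v,x)\}$ and $N_R(c,x)=N(c,x)\cap V(R)$. An induced subgraph $R$ witnesses property (P3) if $N[R]=V(G)$ and for all $c\in V(R)$, $x\in V(G)$ with $d(c,x)\ge 2$, there exists $c'\in N_R(c,x)$ such that for every $y\in V(G)$ with $d(c',y)\ge 2$, either $d(c,y)=d(c,c')+d(c',y)$ or $d(x,y)=d(x,c')+d(c',y)$. For $c\in V(R)$, $x\in V(G)$ with $d(c,x)\ge2$, $C(c,x)=\{u\in N_R(c,x): N[u]\supseteq N[v]\text{ for all }v\in N(c,x)\}$. -}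

module Defs where

open import Data.Nat using (ℕ; zero; suc; _+_; _≤_)
open import Data.Fin using (Fin)
open import Data.Fin.Subset using (Subset; _∈_)
open import Data.Bool using (Bool; true; false; _∧_; _∨_; if_then_else_)
open import Data.List using (allFin)
open import Data.Bool.ListAction using (any)
open import Data.Fin.Properties using (_≟_)
open import Relation.Nullary using (does)
open import Data.Product using (Σ; ∃; ∃-syntax; _×_)
open import Data.Sum using (_⊎_)
open import Relation.Binary.PropositionalEquality using (_≡_)

record Graph (n : ℕ) : Set where
  field
    adj    : Fin n → Fin n → Bool
    sym    : ∀ u v → adj u v ≡ adj v u
    irrefl : ∀ u → adj u u ≡ false

module _ {n : ℕ} (G : Graph n) where
  open Graph G

  reach : ℕ → Fin n → Fin n → Bool
  reach zero    u v = does (u ≟ v)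
  reach (suc k) u v = reach k u v ∨ any (λ w → adj u w ∧ reach k w v) (allFin n)

  Connected : Set
  Connected = ∀ u v → ∃[ k ] (reach k u v ≡ true)

  -- Graph distance d(u,v): least k with a walk of length ≤ k from u to v
  -- (searching k = 0 .. n-1; in a connected graph it is always found).
  private
    search : Fin n → Fin n → ℕ → ℕ → ℕ
    search u v zero    k = k
    search u v (suc f) k = if reach k u v then k else search u v f (suc k)

  d : Fin n → Fin n → ℕ
  d u v = search u v n 0

  N : Fin n → Fin n → Set
  N x y = adj x y ≡ true

  N[_] : Fin n → Fin n → Set
  N[ x ] y = (y ≡ x) ⊎ N x y

  N[R] : Subset n → Fin n → Set
  N[R] R y = ∃[ r ] (r ∈ R × N[ r ] y)

  Ncx : Fin n → Fin n → Fin n → Set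
  Ncx c x v = N c v × d c x ≡ 1 + d v x

  NRcx : Subset n → Fin n → Fin n → Fin n → Set
  NRcx R c x v = v ∈ R × Ncx c x v

  -- R (an induced subgraph, given by its vertex set) witnesses (P3).
  WitnessesP3 : Subset n → Set
  WitnessesP3 R =
    (∀ y → N[R] R y) ×
    (∀ c x → c ∈ R → 2 ≤ d c x →
       ∃[ c' ] (NRcx R c x c' ×
         (∀ y → 2 ≤ d c' y →
            (d c y ≡ d c c' + d c' y) ⊎ (d x y ≡ d x c' + d c' y))))

  Ccx : Subset n → Fin n → Fin n → Fin n → Set
  Ccx R c x u = NRcx R c x u × (∀ v → Ncx c x v → ∀ w → N[ v ] w → N[ u ] w)

module Submission where

open import Defs
open import Data.Nat using (ℕ; _≤_)
open import Data.Fin using (Fin)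
open import Data.Fin.Subset using (Subset; _∈_)
open import Data.Product using (_×_; _,_)

-- Every member of C(c,x) lies in N(c,x), which all members of C(c,x) dominate.
Ccx-N[]-⊆ : ∀ {n} (G : Graph n) {R c x c₁ c₂} →
  Ccx G R c x c₁ → Ccx G R c x c₂ → ∀ w → N[_] G c₁ w → N[_] G c₂ w
Ccx-N[]-⊆ G ((_ , c₁∈Ncx) , _) (_ , c₂-dominates) = c₂-dominates _ c₁∈Ncx

corollary2 : ∀ (n : ℕ) (G : Graph n) → Connected G →
    ∀ (R : Subset n) → WitnessesP3 G R →
    ∀ (c x : Fin n) → c ∈ R → 2 ≤ d G c x →
    ∀ (c₁ c₂ : Fin n) → Ccx G R c x c₁ → Ccx G R c x c₂ →
    (∀ w → N[_] G c₁ w → N[_] G c₂ w) × (∀ w → N[_] G c₂ w → N[_] G c₁ w)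
corollary2 n G _ R _ c x _ _ c₁ c₂ c₁∈C c₂∈C =
  Ccx-N[]-⊆ G c₁∈C c₂∈C , Ccx-N[]-⊆ G c₂∈C c₁∈C
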